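{- For every node $v$ running Algorithm 1 (described in the context), the following invariants hold at the end of each iteration of the main loop: (1) if $\rho_{cw}(v)<\mathrm{ID}(v)$, then $\sigma_{cw}(v)=\rho_{cw}(v)+1$; (2) if $\rho_{cw}(v)\ge\mathrm{ID}(v)$, then $\sigma_{cw}(v)=\rho_{cw}(v)$.
   Context: Oriented ring of $n$ nodes, content-oblivious asynchronous model (content-free pulses, arbitrary finite delays, no loss or injection; each node has an incoming queue per port). Each node $v$ has a unique positive integer ID $\mathrm{ID}(v)$. $\rho_{cw}(v)$ and $\sigma_{cw}(v)$ are the numbers of clockwise (CW) pulses node $v$ has received (consumed from its queue) and sent, respectively, initially 0. Algorithm 1 at node $v$: first send one CW pulse; then loop forever, where each iteration does: if a CW pulse is waiting, consume it (incrementing $\rho_{cw}(v)$); then if $\rho_{cw}(v)=\mathrm{ID}(v)$ set state to Leader (and send nothing), otherwise set state to Non-Leader and send one CW pulse. If no pulse is waiting, the iteration does nothing. -}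

module Defs where

open import Data.Nat using (ℕ; zero; suc; _<_; _≤_; _≡ᵇ_)
open import Data.Bool using (Bool; true; false; if_then_else_)
open import Data.List using (List; []; _∷_)
open import Data.Product using (_×_)
open import Relation.Binary.PropositionalEquality using (_≡_)

data Status : Set where
  undecided leader nonLeader : Status

record NodeState : Set where
  constructor mkState
  field
    rho    : ℕ       -- ρ_cw(v): CW pulses consumed
    sigma  : ℕ       -- σ_cw(v): CW pulses sent
    status : Status
open NodeState public

-- State right before the main loop: one CW pulse has been sent.
initState : NodeState
initState = mkState 0 1 undecided

-- One iteration of the main loop at a node with identifier `id`.
-- The Bool says whether a CW pulse is waiting in the incoming queue
-- (this is determined by the asynchronous environment).
step : ℕ → Bool → NodeState → NodeState
step id false s = s
step id true (mkState r sg st) =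
  if suc r ≡ᵇ id
    then mkState (suc r) sg leader
    else mkState (suc r) (suc sg) nonLeader

run : ℕ → List Bool → NodeState → NodeState
run id []       s = s
run id (b ∷ bs) s = run id bs (step id b s)

Invariant : ℕ → NodeState → Set
Invariant id s =
  (rho s < id → sigma s ≡ suc (rho s)) × (id ≤ rho s → sigma s ≡ rho s)

{-# OPTIONS --safe #-}
module Submission where

open import Defs
open import Data.Nat using (ℕ; suc; _<_; _≡ᵇ_; s≤s⁻¹)
open import Data.Nat.Properties using (≡ᵇ⇒≡; ≡⇒≡ᵇ; <-irrefl; <-trans; n<1+n; ≤-reflexive; ≤∧≢⇒<; <⇒≱)
open import Data.Bool using (Bool; true; false)
open import Data.List using (List; []; _∷_)
open import Data.Product using (_,_)
open import Relation.Nullary using (Reflects; ofʸ; ofⁿ; contradiction)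
open import Relation.Nullary.Reflects using (fromEquivalence)
open import Relation.Binary.PropositionalEquality using (_≡_; _≢_; refl; cong; ≢-sym)

-- The gap σ − ρ starts at 1 and stays 1 while pulses are relayed; it drops to 0
-- exactly when the ID-th pulse is consumed (the node becomes leader and sends
-- nothing), and from then on every consumed pulse is relayed again.

≡ᵇ-reflects-≡ : ∀ m n → Reflects (m ≡ n) (m ≡ᵇ n)
≡ᵇ-reflects-≡ m n = fromEquivalence (≡ᵇ⇒≡ m n) (≡⇒≡ᵇ m n)

Invariant-initState : ∀ {id} → 0 < id → Invariant id initState
Invariant-initState 0<id = (λ _ → refl) , (λ id≤0 → contradiction id≤0 (<⇒≱ 0<id))

Invariant-leader : ∀ {id} s → suc (rho s) ≡ id →
  Invariant id s → Invariant id (mkState (suc (rho s)) (sigma s) leader)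
Invariant-leader _ 1+r≡id (relaying , _) =
  (λ 1+r<id → contradiction 1+r<id (<-irrefl 1+r≡id)) ,
  (λ _ → relaying (≤-reflexive 1+r≡id))

Invariant-nonLeader : ∀ {id} s → suc (rho s) ≢ id →
  Invariant id s → Invariant id (mkState (suc (rho s)) (suc (sigma s)) nonLeader)
Invariant-nonLeader _ 1+r≢id (relaying , decided) =
  (λ 1+r<id → cong suc (relaying (<-trans (n<1+n _) 1+r<id))) ,
  (λ id≤1+r → cong suc (decided (s≤s⁻¹ (≤∧≢⇒< id≤1+r (≢-sym 1+r≢id)))))

step-preserves-Invariant : ∀ id b s → Invariant id s → Invariant id (step id b s)
step-preserves-Invariant id false s inv = inv
step-preserves-Invariant id true s@(mkState r _ _) inv
  with suc r ≡ᵇ id | ≡ᵇ-reflects-≡ (suc r) id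
... | true  | ofʸ 1+r≡id = Invariant-leader s 1+r≡id inv
... | false | ofⁿ 1+r≢id = Invariant-nonLeader s 1+r≢id inv

run-preserves-Invariant : ∀ id bs s → Invariant id s → Invariant id (run id bs s)
run-preserves-Invariant id []       s inv = inv
run-preserves-Invariant id (b ∷ bs) s inv =
  run-preserves-Invariant id bs (step id b s) (step-preserves-Invariant id b s inv)

lemma3p1 : (id : ℕ) → 0 < id → (b : Bool) (bs : List Bool) →
    Invariant id (run id (b ∷ bs) initState)
lemma3p1 id 0<id b bs = run-preserves-Invariant id (b ∷ bs) initState (Invariant-initState 0<id)
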